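{- Let $Q=T[H_1,\dots,H_t]$ be a semicomplete composition (with $T$ on vertices $u_1,\dots,u_t$, $t\ge 2$) that has a 3-king. If $T$ has no source, then $Q$ has at least two 3-kings. In particular, every strong semicomplete composition $Q=T[H_1,\dots,H_t]$ has at least two 3-kings, and for such $Q$ a vertex $v\in V(H_i)$ is a 3-king of $Q$ if and only if $u_i$ is a 3-king of $T$.
   Context: All digraphs are finite, without loops or parallel arcs; paths are directed. Let $T$ be a digraph with vertices $u_1,\dots,u_t$ ($t\ge 2$) and $H_1,\dots,H_t$ digraphs, $H_i$ having vertices $u_{i,j}$, $1\le j\le n_i$. The composition $Q=T[H_1,\dots,H_t]$ has vertex set $\{u_{i,j}\}$ and arc set $\bigcup_i A(H_i)\cup\{u_{i,j}u_{p,q}: u_iu_p\in A(T)\}$ (all $j,q$). It is a semicomplete composition if $T$ is semicomplete, i.e. between every two distinct vertices of $T$ there is at least one arc. A digraph is strong if every vertex can reach every other vertex by a directed path. A source is a vertex of in-degree $0$. A 3-king of a digraph $D$ is a vertex from which every other vertex can be reached by a directed path of length at most 3. -}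

module Defs where

open import Level using (0ℓ)
open import Data.Nat using (ℕ; zero; suc; _≤_)
open import Data.Fin using (Fin)
open import Data.Product using (Σ; ∃; ∃-syntax; _×_; _,_; proj₁)
open import Data.Sum using (_⊎_)
open import Relation.Nullary using (¬_; Dec)
open import Relation.Binary.PropositionalEquality using (_≡_; _≢_)

record Digraph (V : Set) : Set₁ where
  field
    Arc      : V → V → Set
    loopless : ∀ x → ¬ Arc x x
    arc?     : ∀ x y → Dec (Arc x y)
open Digraph public

module _ {V : Set} (R : V → V → Set) where

  data Walk : ℕ → V → V → Set where
    nil  : ∀ {x} → Walk zero x x
    cons : ∀ {n x y z} → R x y → Walk n y z → Walk (suc n) x z

  ReachWithin : ℕ → V → V → Set
  ReachWithin k x y = ∃[ n ] (n ≤ k × Walk n x y)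

  Reach : V → V → Set
  Reach x y = ∃[ n ] Walk n x y

  Is3King : V → Set
  Is3King v = ∀ w → w ≢ v → ReachWithin 3 v w

  AtLeastTwo3Kings : Set
  AtLeastTwo3Kings = ∃[ v ] ∃[ w ] (v ≢ w × Is3King v × Is3King w)

  Has3King : Set
  Has3King = ∃[ v ] Is3King v

  Strong : Set
  Strong = ∀ x y → Reach x y

  IsSource : V → Set
  IsSource x = ∀ y → ¬ R y x

  NoSource : Set
  NoSource = ∀ x → ¬ IsSource x

  Semicomplete : Set
  Semicomplete = ∀ x y → x ≢ y → R x y ⊎ R y x

-- Composition Q = T[H_1,...,H_t]: vertex u_{i,j} is the pair (i , j).
CVertex : (t : ℕ) (ns : Fin t → ℕ) → Set
CVertex t ns = Σ (Fin t) (λ i → Fin (ns i))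

data CompArc {t : ℕ} (T : Digraph (Fin t)) {ns : Fin t → ℕ}
             (Hs : (i : Fin t) → Digraph (Fin (ns i)))
             : CVertex t ns → CVertex t ns → Set where
  inner : ∀ {i j q} → Arc (Hs i) j q → CompArc T Hs (i , j) (i , q)
  outer : ∀ {i p j q} → Arc T i p → CompArc T Hs (i , j) (p , q)

module Submission where

-- A semicomplete digraph T without a source has two distinct 3-kings:
--   * a vertex m of maximum out-degree is a 2-king (Landau): a vertex z that m
--     does not reach in at most two steps beats m and every out-neighbour of m,
--     so z would have strictly larger out-degree;
--   * m has an in-neighbour; among the in-neighbours of m, one w of maximum
--     out-degree is a 3-king: it reaches m in one step, the out-neighbours of m
--     in two, and the remaining vertices are in-neighbours of m, reached from w
--     in at most two steps by the same out-degree argument.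
-- In Q = T[H₁,…,H_t] (all Hᵢ nonempty) a walk of T lifts to a walk of Q of the
-- same length between any chosen vertices of the two blocks, and a walk of Q
-- projects to a walk of T that is no longer.  Hence (p , j) is a 3-king of Q
-- iff p is a 3-king of T, provided p lies on a closed walk of length 2 or 3
-- (needed to reach the other vertices of the block of p); in a semicomplete
-- digraph without source every 3-king lies on such a closed walk.  Finally a
-- strong Q forces T to have no source, because t ≥ 2.

open import Defs
open import Data.Nat using (ℕ; suc; _≤_; _<_; z≤n; s≤s)
open import Data.Nat.Properties using (≤-refl; ≤-trans; <⇒≱; n≤1+n; m≤n⇒m≤1+n)
open import Data.Fin using (Fin; fromℕ<) renaming (zero to fzero; suc to fsuc)
open import Data.Fin.Properties using (_≟_; any?)
open import Data.Fin.Subset using (Subset; ∣_∣) renaming (_∈_ to _∈ₛ_)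
open import Data.Fin.Subset.Properties using (p⊂q⇒∣p∣<∣q∣)
open import Data.Vec using (tabulate)
open import Data.Vec.Properties using (lookup∘tabulate; []=⇒lookup; lookup⇒[]=)
open import Data.Bool using (true)
open import Data.List using (List; allFin; filter)
open import Data.List.Extrema.Nat using (argmax; argmax-all; f[xs]≤f[argmax])
open import Data.List.Membership.Propositional.Properties using (∈-allFin; ∈-filter⁺)
open import Data.List.Relation.Unary.All using (lookup)
open import Data.List.Relation.Unary.All.Properties using (all-filter)
open import Data.Product using (Σ; ∃; ∃-syntax; _×_; _,_; proj₁)
open import Data.Sum using (inj₁; inj₂)
open import Data.Unit using (⊤; tt)
open import Data.Empty using (⊥-elim)
open import Relation.Nullary using (¬_; Dec; yes; no; does)
open import Relation.Nullary.Decidable using (_×-dec_; dec-true)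
open import Relation.Binary.PropositionalEquality using (_≡_; _≢_; refl; sym; trans; cong)
open import Function using (_∘_)
open import Function.Bundles using (_⇔_; mk⇔)

maximiser : ∀ {n} (f : Fin n → ℕ) {P : Fin n → Set} → (∀ x → Dec (P x))
  → ∀ b → P b → Σ (Fin n) λ m → P m × (∀ y → P y → f y ≤ f m)
maximiser {n} f {P} P? b pb = m , argmax-all f pb (all-filter P? (allFin n)) , is-max
  where
    candidates : List (Fin n)
    candidates = filter P? (allFin n)

    m : Fin n
    m = argmax f b candidates

    is-max : ∀ y → P y → f y ≤ f m
    is-max y py = lookup (f[xs]≤f[argmax] b candidates) (∈-filter⁺ P? (∈-allFin y) py)

module Walks {V : Set} (R : V → V → Set) where

  within-mono : ∀ {k l x y} → k ≤ l → ReachWithin R k x y → ReachWithin R l x y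
  within-mono k≤l (n , n≤k , w) = n , ≤-trans n≤k k≤l , w

  lastArc : ∀ {n x y} → Walk R (suc n) x y → ∃ λ c → R c y
  lastArc (cons {x = x} a nil)     = x , a
  lastArc (cons _ w@(cons _ _))    = lastArc w

  reached⇒inNeighbour : ∀ {n x y} → x ≢ y → Walk R n x y → ∃ λ c → R c y
  reached⇒inNeighbour x≢y nil        = ⊥-elim (x≢y refl)
  reached⇒inNeighbour _   w@(cons _ _) = lastArc w

module SemicompleteKings {n : ℕ} (T : Digraph (Fin n)) (sc : Semicomplete (Arc T)) where
  open Walks (Arc T)

  outNbrs : Fin n → Subset n
  outNbrs x = tabulate (λ y → does (arc? T x y))

  outdeg : Fin n → ℕ
  outdeg x = ∣ outNbrs x ∣

  ∈-outNbrs⁺ : ∀ {x y} → Arc T x y → y ∈ₛ outNbrs x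
  ∈-outNbrs⁺ {x} {y} xy =
    lookup⇒[]= y _ (trans (lookup∘tabulate _ y) (dec-true (arc? T x y) xy))

  ∈-outNbrs⁻ : ∀ {x y} → y ∈ₛ outNbrs x → Arc T x y
  ∈-outNbrs⁻ {x} {y} y∈ =
    does≡true⇒ (arc? T x y) (trans (sym (lookup∘tabulate _ y)) ([]=⇒lookup y∈))
    where
      does≡true⇒ : ∀ {A : Set} (a? : Dec A) → does a? ≡ true → A
      does≡true⇒ (yes a) _ = a
      does≡true⇒ (no _) ()

  reverseArc : ∀ {x y} → x ≢ y → ¬ Arc T x y → Arc T y x
  reverseArc {x} {y} x≢y ¬xy with sc x y x≢y
  ... | inj₁ xy = ⊥-elim (¬xy xy)
  ... | inj₂ yx = yx

  -- If x reaches z ≠ x neither in one nor in two steps, then z beats x and all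
  -- out-neighbours of x, so N⁺(x) ⊂ N⁺(z) (strictly, by x itself).
  unreached⇒outdeg< : ∀ {x z} → z ≢ x → ¬ Arc T x z
    → (∀ y → Arc T x y → ¬ Arc T y z) → outdeg x < outdeg z
  unreached⇒outdeg< {x} {z} z≢x ¬xz no2 =
    p⊂q⇒∣p∣<∣q∣ (N⁺x⊆N⁺z , x , ∈-outNbrs⁺ zx , loopless T x ∘ ∈-outNbrs⁻)
    where
      zx : Arc T z x
      zx = reverseArc (z≢x ∘ sym) ¬xz
      N⁺x⊆N⁺z : ∀ {y} → y ∈ₛ outNbrs x → y ∈ₛ outNbrs z
      N⁺x⊆N⁺z {y} y∈ with ∈-outNbrs⁻ y∈ | y ≟ z
      ... | xy | yes refl = ⊥-elim (¬xz xy)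
      ... | xy | no y≢z   = ∈-outNbrs⁺ (reverseArc y≢z (no2 y xy))

  maxOutdeg⇒reaches : (S : Fin n → Set) {x : Fin n}
    → (∀ y → S y → outdeg y ≤ outdeg x)
    → ∀ z → S z → z ≢ x → ReachWithin (Arc T) 2 x z
  maxOutdeg⇒reaches S {x} max z sz z≢x
    with arc? T x z | any? (λ y → arc? T x y ×-dec arc? T y z)
  ... | yes xz | _                 = 1 , s≤s z≤n , cons xz nil
  ... | no _   | yes (y , xy , yz) = 2 , ≤-refl , cons xy (cons yz nil)
  ... | no ¬xz | no ¬2             = ⊥-elim (<⇒≱
    (unreached⇒outdeg< z≢x ¬xz (λ y xy yz → ¬2 (y , xy , yz))) (max z sz))

  maxOutdeg⇒3king : ∀ {m} → (∀ y → outdeg y ≤ outdeg m) → Is3King (Arc T) m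
  maxOutdeg⇒3king max z z≢m =
    within-mono (n≤1+n 2) (maxOutdeg⇒reaches (λ _ → ⊤) (λ y _ → max y) z tt z≢m)

  maxInNeighbour⇒3king : ∀ {m w} → Arc T w m
    → (∀ y → Arc T y m → outdeg y ≤ outdeg w) → Is3King (Arc T) w
  maxInNeighbour⇒3king {m} {w} wm max z z≢w with z ≟ m | arc? T m z
  ... | yes refl | _      = 1 , s≤s z≤n , cons wm nil
  ... | no _     | yes mz = 2 , s≤s (s≤s z≤n) , cons wm (cons mz nil)
  ... | no z≢m   | no ¬mz = within-mono (n≤1+n 2)
    (maxOutdeg⇒reaches (λ y → Arc T y m) max z (reverseArc (z≢m ∘ sym) ¬mz) z≢w)

  inNeighbour : NoSource (Arc T) → ∀ x → ∃ λ y → Arc T y x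
  inNeighbour noSource x with any? (λ y → arc? T y x)
  ... | yes yx = yx
  ... | no ¬yx = ⊥-elim (noSource x (λ y yx → ¬yx (y , yx)))

  twoKings : NoSource (Arc T) → Fin n → AtLeastTwo3Kings (Arc T)
  twoKings noSource x₀ with maximiser outdeg {P = λ _ → ⊤} (λ _ → yes tt) x₀ tt
  ... | m , _ , m-max with inNeighbour noSource m
  ... | w₀ , w₀m with maximiser outdeg (λ y → arc? T y m) w₀ w₀m
  ... | w , wm , w-max =
    m , w , (λ { refl → loopless T m wm })
      , maxOutdeg⇒3king (λ y → m-max y tt) , maxInNeighbour⇒3king wm w-max

  -- In a semicomplete digraph without a source, every 3-king p lies on a
  -- closed walk of length 2 or 3: close up a short walk from p to an
  -- in-neighbour of p, shortcutting walks of length 3 by semicompleteness.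
  closedWalk : NoSource (Arc T) → ∀ {p} → Is3King (Arc T) p
    → ∃[ k ] (k ≤ 2 × Walk (Arc T) (suc k) p p)
  closedWalk noSource {p} king with inNeighbour noSource p
  ... | w , wp with king w (λ { refl → loopless T w wp })
  ... | 0 , _ , nil = ⊥-elim (loopless T w wp)
  ... | 1 , _ , cons a nil = 1 , s≤s z≤n , cons a (cons wp nil)
  ... | 2 , _ , cons a (cons b nil) = 2 , ≤-refl , cons a (cons b (cons wp nil))
  ... | 3 , _ , cons a (cons {y = y} b (cons c nil)) with y ≟ p
  ...   | yes refl = 1 , s≤s z≤n , cons c (cons wp nil)
  ...   | no y≢p with sc y p y≢p
  ...     | inj₁ yp = 2 , ≤-refl , cons a (cons b (cons yp nil))
  ...     | inj₂ py = 2 , ≤-refl , cons py (cons c (cons wp nil))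
  closedWalk noSource king | w , wp | suc (suc (suc (suc _))) , s≤s (s≤s (s≤s ())) , _

module Composition {t : ℕ} (T : Digraph (Fin t)) {ns : Fin t → ℕ}
  (nonempty : ∀ i → 0 < ns i) (Hs : (i : Fin t) → Digraph (Fin (ns i))) where

  Q : CVertex t ns → CVertex t ns → Set
  Q = CompArc T Hs

  vertexOf : ∀ i → Fin (ns i)
  vertexOf i = fromℕ< (nonempty i)

  liftWalk : ∀ {k i p j q} → Walk (Arc T) (suc k) i p → Walk Q (suc k) (i , j) (p , q)
  liftWalk (cons a nil)                 = cons (outer a) nil
  liftWalk (cons {y = y} a w@(cons _ _)) = cons (outer a) (liftWalk {j = vertexOf y} w)

  projectWalk : ∀ {k u v} → Walk Q k u v → ∃[ l ] (l ≤ k × Walk (Arc T) l (proj₁ u) (proj₁ v))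
  projectWalk nil = 0 , z≤n , nil
  projectWalk (cons (inner _) w) with projectWalk w
  ... | l , l≤k , w' = l , m≤n⇒m≤1+n l≤k , w'
  projectWalk (cons (outer a) w) with projectWalk w
  ... | l , l≤k , w' = suc l , s≤s l≤k , cons a w'

  -- Every vertex of the block of a 3-king p of T is a 3-king of Q, provided p
  -- lies on a closed walk of length 2 or 3 (to reach its own block).
  3king-lifts : ∀ {p} → ∃[ k ] (k ≤ 2 × Walk (Arc T) (suc k) p p)
    → Is3King (Arc T) p → ∀ j → Is3King Q (p , j)
  3king-lifts {p} (k , k≤2 , cycle) king j (r , q) _ with r ≟ p
  ... | yes refl = suc k , s≤s k≤2 , liftWalk cycle
  ... | no r≢p with king r r≢p
  ...   | 0 , _ , nil = ⊥-elim (r≢p refl)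
  ...   | suc l , l≤3 , w = suc l , l≤3 , liftWalk w

  3king-projects : ∀ {p j} → Is3King Q (p , j) → Is3King (Arc T) p
  3king-projects king z z≢p with king (z , vertexOf z) (z≢p ∘ cong proj₁)
  ... | k , k≤3 , w with projectWalk w
  ...   | l , l≤k , w' = l , ≤-trans l≤k k≤3 , w'

  strong⇒noSource : (∀ x → ∃ λ y → y ≢ x) → Strong Q → NoSource (Arc T)
  strong⇒noSource other strong x source with other x
  ... | y , y≢x with strong (y , vertexOf y) (x , vertexOf x)
  ...   | _ , w with projectWalk w
  ...     | _ , _ , w' with Walks.reached⇒inNeighbour (Arc T) y≢x w'
  ...       | c , cx = source c cx

anotherVertex : ∀ {t} → 2 ≤ t → (x : Fin t) → ∃ λ y → y ≢ x
anotherVertex (s≤s (s≤s _)) fzero    = fsuc fzero , λ ()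
anotherVertex (s≤s (s≤s _)) (fsuc _) = fzero , λ ()

theorem2p8 : (t : ℕ) → 2 ≤ t → (T : Digraph (Fin t)) → Semicomplete (Arc T)
    → (ns : Fin t → ℕ) → (∀ i → 0 < ns i)
    → (Hs : (i : Fin t) → Digraph (Fin (ns i)))
    → ((Has3King (CompArc T Hs) → NoSource (Arc T) → AtLeastTwo3Kings (CompArc T Hs))
    × (Strong (CompArc T Hs) → AtLeastTwo3Kings (CompArc T Hs))
    × (Strong (CompArc T Hs) → (v : CVertex t ns)
    → Is3King (CompArc T Hs) v ⇔ Is3King (Arc T) (proj₁ v)))
theorem2p8 t 2≤t T sc ns nonempty Hs =
    (λ _ → twoKingsQ)
  , twoKingsQ ∘ noSource
  , λ strong (p , j) → mk⇔ 3king-projects (λ king → kingLifts (noSource strong) king j)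
  where
    open SemicompleteKings T sc
    open Composition T nonempty Hs

    noSource : Strong Q → NoSource (Arc T)
    noSource = strong⇒noSource (anotherVertex 2≤t)

    kingLifts : NoSource (Arc T) → ∀ {p} → Is3King (Arc T) p → ∀ j → Is3King Q (p , j)
    kingLifts noSrc king = 3king-lifts (closedWalk noSrc king) king

    twoKingsQ : NoSource (Arc T) → AtLeastTwo3Kings Q
    twoKingsQ noSrc with twoKings noSrc (fromℕ< 2≤t)
    ... | m , w , m≢w , king-m , king-w =
      (m , vertexOf m) , (w , vertexOf w) , m≢w ∘ cong proj₁
        , kingLifts noSrc king-m (vertexOf m) , kingLifts noSrc king-w (vertexOf w)
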